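{- The maximum degree, with its canonical hyperparameterisation, is an awesome graph parameter.
   Context: All graphs are finite, simple and undirected; $\alpha,\omega$ denote independence and clique number. A graph class is a set of graphs closed under isomorphism. A hypergraph over $G$ is a nonempty set of subsets of $V(G)$; a hypermapping $\mathcal F$ assigns to each graph $G$ a finite nonempty family $\mathcal F_G$ of hypergraphs over $G$, compatibly with isomorphisms. A basic hyperparameter is a pair $(\mathrm{opt},\mathcal F)$ with $\mathrm{opt}\in\{\mathrm{minmax},\mathrm{maxmin}\}$, with value $\rho(G)=\min_{H\in\mathcal F_G}\max_{X\in H}|X|$ (minmax) or $\max_{H\in\mathcal F_G}\min_{X\in H}|X|$ (maxmin); its independence variant $\alpha\text{ - }\rho$ is defined by the same formulas with $|X|$ replaced by $\alpha(G[X])$. The canonical hyperparameterisation of the maximum degree $\Delta$ is $\mathrm{opt}=\mathrm{minmax}$ and $\mathcal F_G=\{\{N_G(v): v\in V(G)\}\}$, so $\alpha\text{ - }\Delta(G)=\max_{v}\alpha(G[N_G(v)])$. A class $\mathcal G$ has bounded $\sigma$ if there is an integer $c$ with $\sigma(G')\le c$ for every induced subgraph $G'$ of every $G\in\mathcal G$; it has clique-bounded $\sigma$ if there is a nondecreasing $f$ with $\sigma(G')\le f(\omega(G'))$ for all such $G'$. A basic hyperparameter $\rho$ is awesome if, for every graph class, clique-bounded $\rho$ is equivalent to bounded $\alpha\text{ - }\rho$. -}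

module Defs where

open import Level using (Level; Setω)
import Data.Nat as ℕ
open import Data.Nat using (ℕ; _≤_; _⊓_) renaming (_⊔_ to _⊔ℕ_)
open import Data.Bool using (Bool; true; false; not; _∧_; _∨_; if_then_else_)
open import Data.Fin using (Fin; _≟_)
open import Data.Fin.Subset using (Subset; ∣_∣; inside; outside; ⊤)
open import Data.Vec using (Vec; []; _∷_; lookup; tabulate)
open import Data.List.Base using (List; []; _∷_; map; foldr; _++_; [_])
open import Data.List.NonEmpty using (List⁺; foldr₁) renaming (map to map⁺; [_] to [_]⁺)
open import Data.List using () renaming (allFin to allFinL)
open import Data.Product using (Σ; ∃; _×_)
open import Relation.Nullary.Decidable using (⌊_⌋)
open import Relation.Binary.PropositionalEquality using (_≡_)
open import Function.Definitions using (Injective)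
open import Function.Bundles using (_⇔_)

record Graph : Set where
  field
    n          : ℕ
    adj        : Fin n → Fin n → Bool
    adj-sym    : ∀ i j → adj i j ≡ adj j i
    adj-irrefl : ∀ i → adj i i ≡ false
open Graph public

record Iso (G H : Graph) : Set where
  field
    to       : Fin (n G) → Fin (n H)
    from     : Fin (n H) → Fin (n G)
    from-to  : ∀ i → from (to i) ≡ i
    to-from  : ∀ j → to (from j) ≡ j
    adj-pres : ∀ i j → adj H (to i) (to j) ≡ adj G i j

InducedSubgraph : Graph → Graph → Set
InducedSubgraph G' G =
  Σ (Fin (n G') → Fin (n G)) λ f →
    Injective _≡_ _≡_ f × (∀ i j → adj G' i j ≡ adj G (f i) (f j))

record GraphClass (ℓ : Level) : Set (Level.suc ℓ) where
  field
    member : Graph → Set ℓ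
    closed : ∀ {G H} → Iso G H → member G → member H
open GraphClass public

subsets : (k : ℕ) → List (Subset k)
subsets ℕ.zero    = [ [] ]
subsets (ℕ.suc k) = map (outside ∷_) (subsets k) ++ map (inside ∷_) (subsets k)

allᵇ : ∀ {A : Set} → (A → Bool) → List A → Bool
allᵇ p = foldr (λ x b → p x ∧ b) true

maxL : List ℕ → ℕ
maxL = foldr _⊔ℕ_ 0

minL : List ℕ → ℕ
minL []       = 0
minL (x ∷ xs) = foldr _⊓_ x xs

maxL⁺ : List⁺ ℕ → ℕ
maxL⁺ = foldr₁ _⊔ℕ_

minL⁺ : List⁺ ℕ → ℕ
minL⁺ = foldr₁ _⊓_

module _ (G : Graph) where
  private V = allFinL (n G)

  subsetOf : Subset (n G) → Subset (n G) → Bool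
  subsetOf S X = allᵇ (λ i → not (lookup S i) ∨ lookup X i) V

  isIndependent : Subset (n G) → Bool
  isIndependent S =
    allᵇ (λ i → allᵇ (λ j → not (lookup S i ∧ lookup S j ∧ adj G i j)) V) V

  isClique : Subset (n G) → Bool
  isClique S =
    allᵇ (λ i → allᵇ (λ j → not (lookup S i ∧ lookup S j) ∨ adj G i j ∨ ⌊ i ≟ j ⌋) V) V

  -- α(G[X]) : largest independent set of G contained in X
  αOn : Subset (n G) → ℕ
  αOn X = maxL (map (λ S → if subsetOf S X ∧ isIndependent S then ∣ S ∣ else 0)
                    (subsets (n G)))

  α : ℕ
  α = αOn ⊤

  ω : ℕ
  ω = maxL (map (λ S → if isClique S then ∣ S ∣ else 0) (subsets (n G)))

  N : Fin (n G) → Subset (n G)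
  N v = tabulate (λ u → adj G v u)

data Opt : Set where
  minmax maxmin : Opt

-- A hypermapping: to each graph a finite nonempty family of hypergraphs
Hypermapping : Set
Hypermapping = (G : Graph) → List⁺ (List (Subset (n G)))

record BasicHyperparameter : Set where
  field
    opt : Opt
    F   : Hypermapping
open BasicHyperparameter public

evalOpt : ∀ {k} → Opt → (Subset k → ℕ) → List⁺ (List (Subset k)) → ℕ
evalOpt minmax w 𝓕 = minL⁺ (map⁺ (λ H → maxL (map w H)) 𝓕)
evalOpt maxmin w 𝓕 = maxL⁺ (map⁺ (λ H → minL (map w H)) 𝓕)

value : BasicHyperparameter → Graph → ℕ
value ρ G = evalOpt (opt ρ) ∣_∣ (F ρ G)

αvalue : BasicHyperparameter → Graph → ℕ
αvalue ρ G = evalOpt (opt ρ) (αOn G) (F ρ G)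

Bounded : ∀ {ℓ} → (Graph → ℕ) → GraphClass ℓ → Set ℓ
Bounded σ 𝒢 = ∃ λ c → ∀ G → member 𝒢 G → ∀ G' → InducedSubgraph G' G → σ G' ≤ c

CliqueBounded : ∀ {ℓ} → (Graph → ℕ) → GraphClass ℓ → Set ℓ
CliqueBounded σ 𝒢 =
  ∃ λ (f : ℕ → ℕ) → (∀ {a b} → a ≤ b → f a ≤ f b) ×
    (∀ G → member 𝒢 G → ∀ G' → InducedSubgraph G' G → σ G' ≤ f (ω G'))

Awesome : BasicHyperparameter → Setω
Awesome ρ = ∀ {ℓ} (𝒢 : GraphClass ℓ) →
  CliqueBounded (value ρ) 𝒢 ⇔ Bounded (αvalue ρ) 𝒢

Δ-hyp : BasicHyperparameter
Δ-hyp = record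
  { opt = minmax
  ; F   = λ G → [ map (N G) (allFinL (n G)) ]⁺
  }

-- If α(G[N(v)]) ≤ c throughout the class, then N(v)
-- has no independent set of size c + 1 and no clique of size ω(G), since such a clique together
-- with v would be larger than ω(G); Ramsey's theorem then bounds deg v by R(c + 1, ω(G)).
-- Conversely, an independent set S ⊆ N(v) spans together with v an induced star K₁,∣S∣, whose
-- maximum degree ∣S∣ is at most f(ω(K₁,∣S∣)) = f(2) when Δ is clique-bounded by f.
module Submission where

open import Defs
open import Data.Nat using (ℕ; zero; suc; _≤_; _<_; z≤n; s≤s; s≤s⁻¹; _+_)
open import Data.Nat.Properties
  using (≤-refl; ≤-trans; ≤-reflexive; <⇒≤; n≤1+n; m≤m⊔n; m≤n⊔m; ⊔-lub; +-suc; +-mono-≤; +-mono-<;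
         module ≤-Reasoning)
open import Data.Bool using (Bool; true; false; not; _∧_; _∨_; if_then_else_)
open import Data.Bool.Properties using (∧-conicalˡ; ∧-conicalʳ; ¬-not)
open import Data.Fin using (Fin; zero; suc; _≟_)
open import Data.Fin.Properties using (suc-injective)
open import Data.Fin.Subset
  using (Subset; Empty; ∣_∣; inside; outside; _∈_; _∉_; _⊆_; ⊥; ⊤; ⁅_⁆; _∪_; _∩_; ∁)
open import Data.Fin.Subset.Properties
  using (_∈?_; nonempty?; ⊥⊆; Empty-unique; ∣⊥∣≡0; ∣⊤∣≡n; ∉⊥; x∈⁅x⁆; x∈⁅y⁆⇒x≡y; ∣⁅x⁆∣≡1; ∪-identityˡ;
         x∈p∪q⁺; x∈p∪q⁻; x∈p∩q⁺; x∈p∩q⁻; x∉p⇒x∈∁p; x∈∁p⇒x∉p; ⊆-trans; p⊆q⇒∣p∣≤∣q∣)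
open import Data.Vec using ([]; _∷_; lookup; here; there)
open import Data.Vec.Properties using (lookup∘tabulate; []=⇒lookup; lookup⇒[]=)
open import Data.List.Base using ([]; _∷_; map)
open import Data.List using () renaming (allFin to allFinL)
open import Data.List.Membership.Propositional using () renaming (_∈_ to _∈ₗ_)
open import Data.List.Membership.Propositional.Properties using (∈-allFin; ∈-map⁺; ∈-map⁻; ∈-++⁺ˡ; ∈-++⁺ʳ)
open import Data.List.Relation.Unary.All as All using (All; []; _∷_)
open import Data.List.Relation.Unary.Any using (here; there)
open import Data.Product using (∃; _,_; _×_; proj₁; proj₂)
open import Data.Sum as Sum using (_⊎_; inj₁; inj₂)
open import Function using (_∘_)
open import Function.Bundles using (_⇔_; mk⇔; Equivalence)
open import Function.Definitions using (Injective)
open import Relation.Nullary using (¬_; Dec; yes; no; contradiction)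
open import Relation.Nullary.Decidable using (⌊_⌋)
open import Relation.Binary.PropositionalEquality using (_≡_; _≢_; refl; sym; trans; cong; cong₂; subst)

open Equivalence using (to; from)

∈⇒≤maxL-map : ∀ {A : Set} (f : A → ℕ) {x xs} → x ∈ₗ xs → f x ≤ maxL (map f xs)
∈⇒≤maxL-map f (here refl)                = m≤m⊔n _ _
∈⇒≤maxL-map f {xs = y ∷ _} (there x∈xs) = ≤-trans (∈⇒≤maxL-map f x∈xs) (m≤n⊔m (f y) _)

maxL-map≤ : ∀ {A : Set} (f : A → ℕ) xs {c} → (∀ {x} → x ∈ₗ xs → f x ≤ c) → maxL (map f xs) ≤ c
maxL-map≤ f []       _   = z≤n
maxL-map≤ f (x ∷ xs) f≤c = ⊔-lub (f≤c (here refl)) (maxL-map≤ f xs (f≤c ∘ there))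

∈-subsets : ∀ {k} (S : Subset k) → S ∈ₗ subsets k
∈-subsets []                  = here refl
∈-subsets {suc k} (outside ∷ S) = ∈-++⁺ˡ (∈-map⁺ (outside ∷_) (∈-subsets S))
∈-subsets {suc k} (inside ∷ S)  = ∈-++⁺ʳ (map (outside ∷_) (subsets k)) (∈-map⁺ (inside ∷_) (∈-subsets S))

-- αOn and ω are both of the form maxCard b for a decidable property b of subsets.
maxCard : ∀ {k} → (Subset k → Bool) → ℕ
maxCard {k} b = maxL (map (λ S → if b S then ∣ S ∣ else 0) (subsets k))

module _ {k} (b : Subset k → Bool) where

  ≤maxCard : ∀ S → b S ≡ true → ∣ S ∣ ≤ maxCard b
  ≤maxCard S bS =
    subst (_≤ maxCard b) (cong (if_then ∣ S ∣ else 0) bS) (∈⇒≤maxL-map _ (∈-subsets S))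

  maxCard≤ : ∀ {c} → (∀ S → b S ≡ true → ∣ S ∣ ≤ c) → maxCard b ≤ c
  maxCard≤ {c} bounded = maxL-map≤ _ (subsets k) λ {S} _ → bounded′ S
    where
    bounded′ : ∀ S → (if b S then ∣ S ∣ else 0) ≤ c
    bounded′ S with b S in bS
    ... | true  = bounded S bS
    ... | false = z≤n

allᵇ≡true⇔All : ∀ {A : Set} (p : A → Bool) xs → allᵇ p xs ≡ true ⇔ All (λ x → p x ≡ true) xs
allᵇ≡true⇔All p []       = mk⇔ (λ _ → []) (λ _ → refl)
allᵇ≡true⇔All p (x ∷ xs) = mk⇔ split join
  where
  split : p x ∧ allᵇ p xs ≡ true → All (λ x → p x ≡ true) (x ∷ xs)
  split e = ∧-conicalˡ _ _ e ∷ to (allᵇ≡true⇔All p xs) (∧-conicalʳ _ _ e)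
  join : All (λ x → p x ≡ true) (x ∷ xs) → p x ∧ allᵇ p xs ≡ true
  join (px ∷ pxs) rewrite px = from (allᵇ≡true⇔All p xs) pxs

allᵇ-allFin≡true⇔ : ∀ {k} (p : Fin k → Bool) → allᵇ p (allFinL k) ≡ true ⇔ (∀ i → p i ≡ true)
allᵇ-allFin≡true⇔ {k} p = mk⇔
  (λ e i → All.lookup (to (allᵇ≡true⇔All p (allFinL k)) e) (∈-allFin i))
  (λ h → from (allᵇ≡true⇔All p (allFinL k)) (All.tabulate λ {i} _ → h i))

not-∨≡true⇔ : ∀ a b → not a ∨ b ≡ true ⇔ (a ≡ true → b ≡ true)
not-∨≡true⇔ true  b = mk⇔ (λ e _ → e) (λ h → h refl)
not-∨≡true⇔ false b = mk⇔ (λ _ ()) (λ _ → refl)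

not-∧-∧≡true⇔ : ∀ a b c → not (a ∧ b ∧ c) ≡ true ⇔ (a ≡ true → b ≡ true → c ≡ false)
not-∧-∧≡true⇔ true  true  true  = mk⇔ (λ ()) (λ h → contradiction (h refl refl) λ ())
not-∧-∧≡true⇔ true  true  false = mk⇔ (λ _ _ _ → refl) (λ _ → refl)
not-∧-∧≡true⇔ true  false c     = mk⇔ (λ _ _ ()) (λ _ → refl)
not-∧-∧≡true⇔ false b     c     = mk⇔ (λ _ ()) (λ _ → refl)

not-∧-∨-∨≡true⇔ : ∀ {P : Set} a b c (P? : Dec P) →
                  not (a ∧ b) ∨ c ∨ ⌊ P? ⌋ ≡ true ⇔ (a ≡ true → b ≡ true → ¬ P → c ≡ true)
not-∧-∨-∨≡true⇔ true  true  true  P?      = mk⇔ (λ _ _ _ _ → refl) (λ _ → refl)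
not-∧-∨-∨≡true⇔ true  true  false (yes p) = mk⇔ (λ _ _ _ ¬p → contradiction p ¬p) (λ _ → refl)
not-∧-∨-∨≡true⇔ true  true  false (no ¬p) = mk⇔ (λ ()) (λ h → contradiction (h refl refl ¬p) λ ())
not-∧-∨-∨≡true⇔ true  false c     P?      = mk⇔ (λ _ _ ()) (λ _ → refl)
not-∧-∨-∨≡true⇔ false b     c     P?      = mk⇔ (λ _ ()) (λ _ → refl)

∈⇔lookup≡true : ∀ {k} {x : Fin k} {p : Subset k} → x ∈ p ⇔ lookup p x ≡ true
∈⇔lookup≡true {x = x} {p} = mk⇔ []=⇒lookup (lookup⇒[]= x p)

∣p∪q∣≤∣p∣+∣q∣ : ∀ {k} (p q : Subset k) → ∣ p ∪ q ∣ ≤ ∣ p ∣ + ∣ q ∣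
∣p∪q∣≤∣p∣+∣q∣ []            []            = z≤n
∣p∪q∣≤∣p∣+∣q∣ (outside ∷ p) (outside ∷ q) = ∣p∪q∣≤∣p∣+∣q∣ p q
∣p∪q∣≤∣p∣+∣q∣ (outside ∷ p) (inside ∷ q)  =
  ≤-trans (s≤s (∣p∪q∣≤∣p∣+∣q∣ p q)) (≤-reflexive (sym (+-suc ∣ p ∣ ∣ q ∣)))
∣p∪q∣≤∣p∣+∣q∣ (inside ∷ p)  (outside ∷ q) = s≤s (∣p∪q∣≤∣p∣+∣q∣ p q)
∣p∪q∣≤∣p∣+∣q∣ (inside ∷ p)  (inside ∷ q)  =
  s≤s (≤-trans (∣p∪q∣≤∣p∣+∣q∣ p q) (≤-trans (n≤1+n _) (≤-reflexive (sym (+-suc ∣ p ∣ ∣ q ∣)))))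

∣⁅x⁆∪p∣≡1+∣p∣ : ∀ {k} {x : Fin k} {p : Subset k} → x ∉ p → ∣ ⁅ x ⁆ ∪ p ∣ ≡ suc ∣ p ∣
∣⁅x⁆∪p∣≡1+∣p∣ {x = zero}  {outside ∷ p} _   = cong (suc ∘ ∣_∣) (∪-identityˡ p)
∣⁅x⁆∪p∣≡1+∣p∣ {x = zero}  {inside ∷ p}  x∉p = contradiction here x∉p
∣⁅x⁆∪p∣≡1+∣p∣ {x = suc x} {outside ∷ p} x∉p = ∣⁅x⁆∪p∣≡1+∣p∣ (x∉p ∘ there)
∣⁅x⁆∪p∣≡1+∣p∣ {x = suc x} {inside ∷ p}  x∉p = cong suc (∣⁅x⁆∪p∣≡1+∣p∣ (x∉p ∘ there))

∈⁅x⁆∪p⁻ : ∀ {k} {x y : Fin k} {p : Subset k} → y ∈ ⁅ x ⁆ ∪ p → y ≡ x ⊎ y ∈ p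
∈⁅x⁆∪p⁻ {x = x} {p = p} = Sum.map₁ (x∈⁅y⁆⇒x≡y x) ∘ x∈p∪q⁻ ⁅ x ⁆ p

⁅x⁆∪p⊆q : ∀ {k} {x : Fin k} {p q : Subset k} → x ∈ q → p ⊆ q → ⁅ x ⁆ ∪ p ⊆ q
⁅x⁆∪p⊆q x∈q p⊆q y∈ with ∈⁅x⁆∪p⁻ y∈
... | inj₁ refl = x∈q
... | inj₂ y∈p  = p⊆q y∈p

∣p∣≤1+∣p∩∁⁅x⁆∪q∣+∣p∩q∣ : ∀ {k} (x : Fin k) (q p : Subset k) →
                          ∣ p ∣ ≤ suc (∣ p ∩ ∁ (⁅ x ⁆ ∪ q) ∣ + ∣ p ∩ q ∣)
∣p∣≤1+∣p∩∁⁅x⁆∪q∣+∣p∩q∣ x q p = begin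
  ∣ p ∣                                         ≤⟨ p⊆q⇒∣p∣≤∣q∣ covered ⟩
  ∣ ⁅ x ⁆ ∪ (p ∩ ∁ (⁅ x ⁆ ∪ q) ∪ p ∩ q) ∣       ≤⟨ ∣p∪q∣≤∣p∣+∣q∣ ⁅ x ⁆ _ ⟩
  ∣ ⁅ x ⁆ ∣ + ∣ p ∩ ∁ (⁅ x ⁆ ∪ q) ∪ p ∩ q ∣     ≡⟨ cong (_+ ∣ p ∩ ∁ (⁅ x ⁆ ∪ q) ∪ p ∩ q ∣) (∣⁅x⁆∣≡1 x) ⟩
  suc ∣ p ∩ ∁ (⁅ x ⁆ ∪ q) ∪ p ∩ q ∣           ≤⟨ s≤s (∣p∪q∣≤∣p∣+∣q∣ (p ∩ ∁ (⁅ x ⁆ ∪ q)) (p ∩ q)) ⟩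
  suc (∣ p ∩ ∁ (⁅ x ⁆ ∪ q) ∣ + ∣ p ∩ q ∣)     ∎
  where
  open ≤-Reasoning
  covered : p ⊆ ⁅ x ⁆ ∪ (p ∩ ∁ (⁅ x ⁆ ∪ q) ∪ p ∩ q)
  covered {i} i∈p with i ∈? q
  ... | yes i∈q = x∈p∪q⁺ (inj₂ (x∈p∪q⁺ (inj₂ (x∈p∩q⁺ (i∈p , i∈q)))))
  ... | no  i∉q with i ≟ x
  ... | yes refl = x∈p∪q⁺ (inj₁ (x∈⁅x⁆ x))
  ... | no  i≢x  = x∈p∪q⁺ (inj₂ (x∈p∪q⁺ (inj₁ (x∈p∩q⁺ (i∈p , x∉p⇒x∈∁p
          (Sum.[ i≢x ∘ x∈⁅y⁆⇒x≡y x , i∉q ]′ ∘ x∈p∪q⁻ ⁅ x ⁆ q))))))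

Empty⇒∣p∣≡0 : ∀ {k} {p : Subset k} → Empty p → ∣ p ∣ ≡ 0
Empty⇒∣p∣≡0 {k} p-empty = trans (cong ∣_∣ (Empty-unique p-empty)) (∣⊥∣≡0 k)

∣p∣≤1 : ∀ {k} {p : Subset k} → (∀ {x y} → x ∈ p → y ∈ p → x ≡ y) → ∣ p ∣ ≤ 1
∣p∣≤1 {p = p} unique with nonempty? p
... | no  p-empty   = ≤-trans (≤-reflexive (Empty⇒∣p∣≡0 p-empty)) z≤n
... | yes (x , x∈p) = ≤-trans (p⊆q⇒∣p∣≤∣q∣ λ y∈p → subst (_∈ ⁅ x ⁆) (unique x∈p y∈p) (x∈⁅x⁆ x))
                              (≤-reflexive (∣⁅x⁆∣≡1 x))

∣x∷p∣≤1+∣p∣ : ∀ {k} x (p : Subset k) → ∣ x ∷ p ∣ ≤ suc ∣ p ∣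
∣x∷p∣≤1+∣p∣ outside p = n≤1+n ∣ p ∣
∣x∷p∣≤1+∣p∣ inside  p = ≤-refl

enumerate : ∀ {k} (S : Subset k) → Fin ∣ S ∣ → Fin k
enumerate (inside ∷ S)  zero    = zero
enumerate (inside ∷ S)  (suc i) = suc (enumerate S i)
enumerate (outside ∷ S) i       = suc (enumerate S i)

enumerate-∈ : ∀ {k} (S : Subset k) i → enumerate S i ∈ S
enumerate-∈ (inside ∷ S)  zero    = here
enumerate-∈ (inside ∷ S)  (suc i) = there (enumerate-∈ S i)
enumerate-∈ (outside ∷ S) i       = there (enumerate-∈ S i)

enumerate-injective : ∀ {k} (S : Subset k) → Injective _≡_ _≡_ (enumerate S)
enumerate-injective (inside ∷ S)  {zero}  {zero}  _  = refl
enumerate-injective (inside ∷ S)  {suc i} {suc j} eq = cong suc (enumerate-injective S (suc-injective eq))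
enumerate-injective (outside ∷ S)                 eq = enumerate-injective S (suc-injective eq)

module _ (G : Graph) where

  Independent : Subset (n G) → Set
  Independent S = ∀ {i j} → i ∈ S → j ∈ S → adj G i j ≡ false

  Clique : Subset (n G) → Set
  Clique S = ∀ {i j} → i ∈ S → j ∈ S → i ≢ j → adj G i j ≡ true

  ∈N⇔adj : ∀ {v j} → j ∈ N G v ⇔ adj G v j ≡ true
  ∈N⇔adj {v} {j} = mk⇔
    (λ j∈N → trans (sym (lookup∘tabulate (adj G v) j)) (to ∈⇔lookup≡true j∈N))
    (λ e → from ∈⇔lookup≡true (trans (lookup∘tabulate (adj G v) j) e))

  subsetOf≡true⇔⊆ : ∀ S X → subsetOf G S X ≡ true ⇔ S ⊆ X
  subsetOf≡true⇔⊆ S X = mk⇔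
    (λ e {i} i∈S → from ∈⇔lookup≡true
      (to (not-∨≡true⇔ _ _) (to (allᵇ-allFin≡true⇔ _) e i) (to ∈⇔lookup≡true i∈S)))
    (λ S⊆X → from (allᵇ-allFin≡true⇔ _) λ i → from (not-∨≡true⇔ _ _)
      λ Si → to ∈⇔lookup≡true (S⊆X {i} (from ∈⇔lookup≡true Si)))

  isIndependent≡true⇔ : ∀ S → isIndependent G S ≡ true ⇔ Independent S
  isIndependent≡true⇔ S = mk⇔
    (λ e {i} {j} i∈S j∈S → to (not-∧-∧≡true⇔ _ _ _)
      (to (allᵇ-allFin≡true⇔ _) (to (allᵇ-allFin≡true⇔ _) e i) j)
      (to ∈⇔lookup≡true i∈S) (to ∈⇔lookup≡true j∈S))
    (λ indS → from (allᵇ-allFin≡true⇔ _) λ i → from (allᵇ-allFin≡true⇔ _) λ j →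
      from (not-∧-∧≡true⇔ _ _ _) λ Si Sj →
        indS {i} {j} (from ∈⇔lookup≡true Si) (from ∈⇔lookup≡true Sj))

  isClique≡true⇔ : ∀ S → isClique G S ≡ true ⇔ Clique S
  isClique≡true⇔ S = mk⇔
    (λ e {i} {j} i∈S j∈S → to (not-∧-∨-∨≡true⇔ _ _ _ (i ≟ j))
      (to (allᵇ-allFin≡true⇔ _) (to (allᵇ-allFin≡true⇔ _) e i) j)
      (to ∈⇔lookup≡true i∈S) (to ∈⇔lookup≡true j∈S))
    (λ cl → from (allᵇ-allFin≡true⇔ _) λ i → from (allᵇ-allFin≡true⇔ _) λ j →
      from (not-∧-∨-∨≡true⇔ _ _ _ (i ≟ j)) λ Si Sj →
        cl {i} {j} (from ∈⇔lookup≡true Si) (from ∈⇔lookup≡true Sj))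

  ≤αOn : ∀ {S X} → S ⊆ X → Independent S → ∣ S ∣ ≤ αOn G X
  ≤αOn {S} {X} S⊆X indS = ≤maxCard (λ T → subsetOf G T X ∧ isIndependent G T) S
    (cong₂ _∧_ (from (subsetOf≡true⇔⊆ S X) S⊆X) (from (isIndependent≡true⇔ S) indS))

  αOn≤ : ∀ {X c} → (∀ {S} → S ⊆ X → Independent S → ∣ S ∣ ≤ c) → αOn G X ≤ c
  αOn≤ {X} bounded = maxCard≤ (λ S → subsetOf G S X ∧ isIndependent G S) λ S e →
    bounded (to (subsetOf≡true⇔⊆ S X) (∧-conicalˡ _ _ e)) (to (isIndependent≡true⇔ S) (∧-conicalʳ _ _ e))

  ≤ω : ∀ {S} → Clique S → ∣ S ∣ ≤ ω G
  ≤ω {S} cl = ≤maxCard (isClique G) S (from (isClique≡true⇔ S) cl)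

  ω≤ : ∀ {c} → (∀ {S} → Clique S → ∣ S ∣ ≤ c) → ω G ≤ c
  ω≤ bounded = maxCard≤ (isClique G) λ S e → bounded (to (isClique≡true⇔ S) e)

  Independent-⁅⁆∪ : ∀ {u S} → Independent S → (∀ {j} → j ∈ S → adj G u j ≡ false) →
                     Independent (⁅ u ⁆ ∪ S)
  Independent-⁅⁆∪ {u} indS nonAdj i∈ j∈ with ∈⁅x⁆∪p⁻ i∈ | ∈⁅x⁆∪p⁻ j∈
  ... | inj₁ refl | inj₁ refl = adj-irrefl G u
  ... | inj₁ refl | inj₂ j∈S  = nonAdj j∈S
  ... | inj₂ i∈S  | inj₁ refl = trans (adj-sym G _ u) (nonAdj i∈S)
  ... | inj₂ i∈S  | inj₂ j∈S  = indS i∈S j∈S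

  Clique-⁅⁆∪ : ∀ {u S} → Clique S → (∀ {j} → j ∈ S → adj G u j ≡ true) → Clique (⁅ u ⁆ ∪ S)
  Clique-⁅⁆∪ {u} clS adjacent i∈ j∈ i≢j with ∈⁅x⁆∪p⁻ i∈ | ∈⁅x⁆∪p⁻ j∈
  ... | inj₁ refl | inj₁ refl = contradiction refl i≢j
  ... | inj₁ refl | inj₂ j∈S  = adjacent j∈S
  ... | inj₂ i∈S  | inj₁ refl = trans (adj-sym G _ u) (adjacent i∈S)
  ... | inj₂ i∈S  | inj₂ j∈S  = clS i∈S j∈S i≢j

  ∉N : ∀ v → v ∉ N G v
  ∉N v v∈N = contradiction (trans (sym (adj-irrefl G v)) (to ∈N⇔adj v∈N)) λ ()

  clique⊆N⇒<ω : ∀ {v S} → S ⊆ N G v → Clique S → ∣ S ∣ < ω G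
  clique⊆N⇒<ω {v} {S} S⊆N clS = begin-strict
    ∣ S ∣             <⟨ ≤-refl ⟩
    suc ∣ S ∣         ≡⟨ sym (∣⁅x⁆∪p∣≡1+∣p∣ (∉N v ∘ S⊆N)) ⟩
    ∣ ⁅ v ⁆ ∪ S ∣     ≤⟨ ≤ω (Clique-⁅⁆∪ clS (to ∈N⇔adj ∘ S⊆N)) ⟩
    ω G               ∎
    where open ≤-Reasoning

module _ (G : Graph) (w : Subset (n G) → ℕ) where

  ≤maxOverNeighbourhoods : ∀ v → w (N G v) ≤ evalOpt (opt Δ-hyp) w (F Δ-hyp G)
  ≤maxOverNeighbourhoods v = ∈⇒≤maxL-map w (∈-map⁺ (N G) (∈-allFin v))

  maxOverNeighbourhoods≤ : ∀ {c} → (∀ v → w (N G v) ≤ c) → evalOpt (opt Δ-hyp) w (F Δ-hyp G) ≤ c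
  maxOverNeighbourhoods≤ {c} bounded = maxL-map≤ w _ λ S∈ → neighbourhood≤ (∈-map⁻ (N G) S∈)
    where
    neighbourhood≤ : ∀ {S} → ∃ (λ v → v ∈ₗ allFinL (n G) × S ≡ N G v) → w S ≤ c
    neighbourhood≤ (v , _ , refl) = bounded v

-- The Erdős–Szekeres recursion R(a, b) ≤ R(a - 1, b) + R(a, b - 1) for the Ramsey numbers.
r : ℕ → ℕ → ℕ
r zero    b       = 0
r (suc a) zero    = 0
r (suc a) (suc b) = suc (r a (suc b) + r (suc a) b)

r-monoʳ : ∀ a {b b′} → b ≤ b′ → r a b ≤ r a b′
r-monoʳ zero    _           = z≤n
r-monoʳ (suc a) {zero}  _   = z≤n
r-monoʳ (suc a) {suc b} {suc b′} (s≤s b≤b′) =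
  s≤s (+-mono-≤ (r-monoʳ a (s≤s b≤b′)) (r-monoʳ (suc a) b≤b′))

module _ (G : Graph) where

  ramsey : ∀ a b (X : Subset (n G)) →
           (∀ {S} → S ⊆ X → Independent G S → ∣ S ∣ < a) →
           (∀ {S} → S ⊆ X → Clique G S → ∣ S ∣ < b) →
           ∣ X ∣ < r a b
  ramsey zero    b       X indep< _       = contradiction (indep< ⊥⊆ λ i∈⊥ _ → contradiction i∈⊥ ∉⊥) λ ()
  ramsey (suc a) zero    X _      clique< = contradiction (clique< ⊥⊆ λ i∈⊥ _ _ → contradiction i∈⊥ ∉⊥) λ ()
  ramsey (suc a) (suc b) X indep< clique< with nonempty? X
  ... | no  X-empty   = s≤s (≤-trans (≤-reflexive (Empty⇒∣p∣≡0 X-empty)) z≤n)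
  ... | yes (u , u∈X) = begin-strict
    ∣ X ∣                      ≤⟨ ∣p∣≤1+∣p∩∁⁅x⁆∪q∣+∣p∩q∣ u (N G u) X ⟩
    suc (∣ NonAdj ∣ + ∣ Adj ∣) <⟨ s≤s (+-mono-< NonAdj< Adj<) ⟩
    r (suc a) (suc b)          ∎
    where
    open ≤-Reasoning
    Adj NonAdj : Subset (n G)
    Adj    = X ∩ N G u
    NonAdj = X ∩ ∁ (⁅ u ⁆ ∪ N G u)

    Adj⊆X : Adj ⊆ X
    Adj⊆X = proj₁ ∘ x∈p∩q⁻ X (N G u)
    NonAdj⊆X : NonAdj ⊆ X
    NonAdj⊆X = proj₁ ∘ x∈p∩q⁻ X _

    adjacent : ∀ {j} → j ∈ Adj → adj G u j ≡ true
    adjacent = to (∈N⇔adj G) ∘ proj₂ ∘ x∈p∩q⁻ X (N G u)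
    nonAdjacent : ∀ {j} → j ∈ NonAdj → adj G u j ≡ false
    nonAdjacent j∈ = ¬-not λ e →
      x∈∁p⇒x∉p (proj₂ (x∈p∩q⁻ X _ j∈)) (x∈p∪q⁺ (inj₂ (from (∈N⇔adj G) e)))

    u∉Adj : u ∉ Adj
    u∉Adj = ∉N G u ∘ proj₂ ∘ x∈p∩q⁻ X (N G u)
    u∉NonAdj : u ∉ NonAdj
    u∉NonAdj u∈ = x∈∁p⇒x∉p (proj₂ (x∈p∩q⁻ X _ u∈)) (x∈p∪q⁺ (inj₁ (x∈⁅x⁆ u)))

    Adj< : ∣ Adj ∣ < r (suc a) b
    Adj< = ramsey (suc a) b Adj (λ S⊆Adj → indep< (⊆-trans S⊆Adj Adj⊆X)) λ {S} S⊆Adj clS →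
      s≤s⁻¹ (subst (_< suc b) (∣⁅x⁆∪p∣≡1+∣p∣ (u∉Adj ∘ S⊆Adj))
        (clique< (⁅x⁆∪p⊆q u∈X (⊆-trans S⊆Adj Adj⊆X)) (Clique-⁅⁆∪ G clS (adjacent ∘ S⊆Adj))))

    NonAdj< : ∣ NonAdj ∣ < r a (suc b)
    NonAdj< = ramsey a (suc b) NonAdj (λ {S} S⊆NonAdj indS →
      s≤s⁻¹ (subst (_< suc a) (∣⁅x⁆∪p∣≡1+∣p∣ (u∉NonAdj ∘ S⊆NonAdj))
        (indep< (⁅x⁆∪p⊆q u∈X (⊆-trans S⊆NonAdj NonAdj⊆X))
                (Independent-⁅⁆∪ G indS (nonAdjacent ∘ S⊆NonAdj)))))
      (λ S⊆NonAdj → clique< (⊆-trans S⊆NonAdj NonAdj⊆X))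

InducedSubgraph-trans : ∀ {A B C} → InducedSubgraph A B → InducedSubgraph B C → InducedSubgraph A C
InducedSubgraph-trans (f , f-inj , f-adj) (g , g-inj , g-adj) =
  g ∘ f , f-inj ∘ g-inj , λ i j → trans (f-adj i j) (g-adj (f i) (f j))

Star : ℕ → Graph
Star k = record { n = suc k ; adj = starAdj ; adj-sym = starAdj-sym ; adj-irrefl = starAdj-irrefl }
  where
  starAdj : Fin (suc k) → Fin (suc k) → Bool
  starAdj zero    zero    = false
  starAdj zero    (suc _) = true
  starAdj (suc _) zero    = true
  starAdj (suc _) (suc _) = false
  starAdj-sym : ∀ i j → starAdj i j ≡ starAdj j i
  starAdj-sym zero    zero    = refl
  starAdj-sym zero    (suc _) = refl
  starAdj-sym (suc _) zero    = refl
  starAdj-sym (suc _) (suc _) = refl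
  starAdj-irrefl : ∀ i → starAdj i i ≡ false
  starAdj-irrefl zero    = refl
  starAdj-irrefl (suc _) = refl

≤Δ-Star : ∀ k → k ≤ value Δ-hyp (Star k)
≤Δ-Star k = begin
  k                             ≡⟨ sym (∣⊤∣≡n k) ⟩
  ∣ outside ∷ ⊤ {k} ∣           ≤⟨ p⊆q⇒∣p∣≤∣q∣ leaves⊆N ⟩
  ∣ N (Star k) zero ∣           ≤⟨ ≤maxOverNeighbourhoods (Star k) ∣_∣ zero ⟩
  value Δ-hyp (Star k)          ∎
  where
  open ≤-Reasoning
  leaves⊆N : outside ∷ ⊤ ⊆ N (Star k) zero
  leaves⊆N (there _) = from (∈N⇔adj (Star k) {zero}) refl

-- Two leaves are never adjacent, so a clique contains at most one leaf.
ω-Star≤2 : ∀ k → ω (Star k) ≤ 2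
ω-Star≤2 k = ω≤ (Star k) λ {S} → clique≤2 S
  where
  clique≤2 : ∀ S → Clique (Star k) S → ∣ S ∣ ≤ 2
  clique≤2 (centre ∷ leaves) clS = ≤-trans (∣x∷p∣≤1+∣p∣ centre leaves) (s≤s (∣p∣≤1 sameLeaf))
    where
    sameLeaf : ∀ {i j} → i ∈ leaves → j ∈ leaves → i ≡ j
    sameLeaf {i} {j} i∈ j∈ with i ≟ j
    ... | yes i≡j = i≡j
    ... | no  i≢j = contradiction (clS (there i∈) (there j∈) (i≢j ∘ suc-injective)) λ ()

Star⊑ : ∀ G v {S} → S ⊆ N G v → Independent G S → InducedSubgraph (Star ∣ S ∣) G
Star⊑ G v {S} S⊆N indS = embed , (λ {x} {y} → embed-injective x y) , embed-adj
  where
  embed : Fin (suc ∣ S ∣) → Fin (n G)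
  embed zero    = v
  embed (suc i) = enumerate S i

  adjacent : ∀ i → adj G v (enumerate S i) ≡ true
  adjacent i = to (∈N⇔adj G) (S⊆N (enumerate-∈ S i))

  v≢enumerate : ∀ i → v ≢ enumerate S i
  v≢enumerate i v≡ = ∉N G v (subst (_∈ N G v) (sym v≡) (S⊆N (enumerate-∈ S i)))

  embed-injective : ∀ x y → embed x ≡ embed y → x ≡ y
  embed-injective zero    zero    _  = refl
  embed-injective zero    (suc j) eq = contradiction eq (v≢enumerate j)
  embed-injective (suc i) zero    eq = contradiction (sym eq) (v≢enumerate i)
  embed-injective (suc i) (suc j) eq = cong suc (enumerate-injective S eq)

  embed-adj : ∀ i j → adj (Star ∣ S ∣) i j ≡ adj G (embed i) (embed j)
  embed-adj zero    zero    = sym (adj-irrefl G v)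
  embed-adj zero    (suc j) = sym (adjacent j)
  embed-adj (suc i) zero    = sym (trans (adj-sym G _ v) (adjacent i))
  embed-adj (suc i) (suc j) = sym (indS (enumerate-∈ S i) (enumerate-∈ S j))

cliqueBoundedΔ⇒boundedαΔ : ∀ {ℓ} (𝒢 : GraphClass ℓ) →
                           CliqueBounded (value Δ-hyp) 𝒢 → Bounded (αvalue Δ-hyp) 𝒢
cliqueBoundedΔ⇒boundedαΔ 𝒢 (f , f-mono , Δ≤fω) = f 2 , λ G G∈𝒢 G′ G′⊑G →
  maxOverNeighbourhoods≤ G′ (αOn G′) λ v → αOn≤ G′ λ {S} S⊆N indS → begin
    ∣ S ∣                       ≤⟨ ≤Δ-Star ∣ S ∣ ⟩
    value Δ-hyp (Star ∣ S ∣)    ≤⟨ Δ≤fω G G∈𝒢 (Star ∣ S ∣)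
                                     (InducedSubgraph-trans {Star ∣ S ∣} {G′} {G} (Star⊑ G′ v {S} S⊆N indS) G′⊑G) ⟩
    f (ω (Star ∣ S ∣))          ≤⟨ f-mono (ω-Star≤2 ∣ S ∣) ⟩
    f 2                         ∎
  where open ≤-Reasoning

boundedαΔ⇒cliqueBoundedΔ : ∀ {ℓ} (𝒢 : GraphClass ℓ) →
                           Bounded (αvalue Δ-hyp) 𝒢 → CliqueBounded (value Δ-hyp) 𝒢
boundedαΔ⇒cliqueBoundedΔ 𝒢 (c , αΔ≤c) = r (suc c) , r-monoʳ (suc c) , λ G G∈𝒢 G′ G′⊑G →
  maxOverNeighbourhoods≤ G′ ∣_∣ λ v → <⇒≤ (ramsey G′ (suc c) (ω G′) (N G′ v)
    (λ S⊆N indS → s≤s (≤-trans (≤αOn G′ S⊆N indS)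
                               (≤-trans (≤maxOverNeighbourhoods G′ (αOn G′) v) (αΔ≤c G G∈𝒢 G′ G′⊑G))))
    (clique⊆N⇒<ω G′))

proposition5p2 : Awesome Δ-hyp
proposition5p2 𝒢 = mk⇔ (cliqueBoundedΔ⇒boundedαΔ 𝒢) (boundedαΔ⇒cliqueBoundedΔ 𝒢)
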